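{- Let $A$ be a finite set of integers with $|A| \geq 2$ and let $r \geq 2$ be an integer. Then $A$ is an $(r,2)$-approximate group if and only if either $r = 2$ and $A$ is an arithmetic progression, or $r = 3$ and $|A| = 2$.
   Context: For nonempty subsets $A, X$ of an additive abelian group $G$ (here $G=\mathbb{Z}$), $X+A=\{x+a : x\in X, a\in A\}$ and, for a positive integer $h$, $hA=\{a_1+\cdots+a_h : a_i \in A\}$. For positive integers $r,\ell$, a set $A$ is an $(r,\ell)$-approximate group if $A$ is a nonempty subset of $G$ and there exists a subset $X$ of $G$ with $|X| \leq \ell$ and $rA \subseteq X + A$. -}

module Defs where

open import Data.Nat using (ℕ; _≤_; _<_)
open import Data.Integer using (ℤ; _+_; _*_; +_; 0ℤ)
open import Data.Fin using (Fin)
open import Data.List using (List; length)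
open import Data.List.Membership.Propositional using (_∈_)
open import Data.Product using (Σ; ∃; ∃-syntax; _×_)
open import Data.Vec.Functional using (Vector)
open import Data.Vec.Functional as VF using ()
open import Relation.Binary.PropositionalEquality using (_≡_; _≢_)
open import Function.Bundles using (_⇔_)

-- Finite sets of integers are represented by lists (the set of their
-- elements).  Membership is list membership.

sumFin : ∀ {h} → (Fin h → ℤ) → ℤ
sumFin = VF.foldr _+_ 0ℤ

InSumset : ℕ → List ℤ → ℤ → Set
InSumset h A y = Σ (Fin h → ℤ) λ f → ((i : Fin h) → f i ∈ A) × sumFin f ≡ y

InPlus : List ℤ → List ℤ → ℤ → Set
InPlus X A y = ∃[ x ] ∃[ a ] (x ∈ X × a ∈ A × y ≡ x + a)

-- A is an (r,ℓ)-approximate group: A nonempty and there is X ⊆ ℤ with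
-- |X| ≤ ℓ and rA ⊆ X + A.  (A list X of length ≤ ℓ describes exactly the
-- finite sets of size ≤ ℓ.)
ApproxGroup : ℕ → ℕ → List ℤ → Set
ApproxGroup r ℓ A =
  (∃[ a ] a ∈ A) ×
  (Σ (List ℤ) λ X → length X ≤ ℓ × (∀ y → InSumset r A y → InPlus X A y))

IsAP : List ℤ → Set
IsAP A = ∃[ a ] ∃[ d ] ∃[ k ]
  (d ≢ 0ℤ × (∀ y → (y ∈ A) ⇔ (∃[ i ] (i < k × y ≡ a + (+ i) * d))))

-- Let m < M be the least and greatest elements of A and rA ⊆ X + A, |X| ≤ 2.
-- The element r·m can only lie in a translate x₁ + A with x₁ + m ≤ r·m, and
-- r·M only in one with r·M ≤ x₂ + M; these translates differ, so
-- rA ⊆ (x₁ + A) ∪ (x₂ + A) (two-translates), and hence rA avoids the open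
-- interval between (r - 1)·m + M and (r - 1)·M + m (gap).
-- * r ≥ 3: for c ∈ A with c > m, the element M + c + (r - 2)·m of rA forces
--   c ≥ M + (r - 3)(M - m).  With c = M this excludes r ≥ 4; for r = 3 it
--   leaves A = {m, M}.
-- * r = 2: x₁ ≤ m and M ≤ x₂.  If x₁ < m, A is closed under a ↦ a + (m - x₁)
--   below M; if M < x₂, the reflection -A is; otherwise A is closed under
--   a ↦ a + (a₁ - m), a₁ the successor of m.  A set closed under a positive
--   step below its maximum is an arithmetic progression (StepClosed).
-- Conversely a progression a, …, a + K·d satisfies 2A ⊆ {a, a + K·d} + A, and
-- {p, q} satisfies 3A ⊆ {2p, 2q} + A by the pigeonhole principle.

module Submission where

open import Defs
open import Data.Nat as ℕ using (ℕ; _≤_; zero; suc; s≤s; z≤n)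
import Data.Nat.Properties as ℕP
open import Data.Integer as ℤ using (ℤ; +_; 0ℤ; 1ℤ; -_; _-_; ∣_∣; _+_; _*_)
  renaming (_≤_ to _≤ᶻ_; _<_ to _<ᶻ_)
import Data.Integer.Properties as ℤP
open import Data.Integer.Tactic.RingSolver using (solve-∀)
open import Algebra.Properties.AbelianGroup ℤP.+-0-abelianGroup using (∙-cancelʳ)
open import Data.Fin using () renaming (zero to fzero; suc to fsuc)
import Data.Vec.Functional as Vector
open import Data.List using (List; []; _∷_; length; filter)
open import Data.List.Membership.Propositional using (_∈_)
open import Data.List.Membership.Propositional.Properties using (∈-filter⁺; ∈-filter⁻)
open import Data.List.Relation.Unary.Any using (here; there)
open import Data.List.Relation.Unary.All as All using (_∷_)
open import Data.List.Relation.Unary.AllPairs using (_∷_)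
open import Data.List.Relation.Unary.Unique.Propositional using (Unique)
import Data.List.Extrema ℤP.≤-totalOrder as Extrema
open import Data.Product using (_×_; ∃-syntax; _,_)
open import Data.Sum using (_⊎_; inj₁; inj₂; map; swap)
open import Data.Empty using (⊥; ⊥-elim)
open import Function using (id)
open import Function.Bundles using (_⇔_; mk⇔; Equivalence)
open import Relation.Binary.PropositionalEquality
  using (_≡_; _≢_; refl; sym; trans; cong; subst; subst₂; module ≡-Reasoning)
open import Relation.Nullary using (yes; no; contradiction)

cancelʳ-≤ : ∀ {a b} c → a + c ≤ᶻ b + c → a ≤ᶻ b
cancelʳ-≤ {a} {b} c le = begin
  a          ≡⟨ add-sub a c ⟨
  a + c - c  ≤⟨ ℤP.+-monoˡ-≤ (- c) le ⟩
  b + c - c  ≡⟨ add-sub b c ⟩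
  b          ∎
  where
  open ℤP.≤-Reasoning
  add-sub : ∀ x y → x + y - y ≡ x
  add-sub = solve-∀

cancelˡ-≤ : ∀ {a b} c → c + a ≤ᶻ c + b → a ≤ᶻ b
cancelˡ-≤ {a} {b} c le =
  cancelʳ-≤ c (subst₂ _≤ᶻ_ (ℤP.+-comm c a) (ℤP.+-comm c b) le)

≤-+ : ∀ a {e} → 0ℤ ≤ᶻ e → a ≤ᶻ a + e
≤-+ a 0≤e = ℤP.i≤i+j a _ {{ℤ.nonNegative 0≤e}}

<-+ : ∀ a {e} → 0ℤ <ᶻ e → a <ᶻ a + e
<-+ a 0<e = subst (_<ᶻ a + _) (ℤP.+-identityʳ a) (ℤP.+-monoʳ-< a 0<e)

summand : ∀ {x b y} → y ≡ x + b → b ≡ y - x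
summand {x} {b} refl = sol x b
  where
  sol : ∀ x b → b ≡ x + b - x
  sol = solve-∀

swap-last : ∀ a b c → a + b + c ≡ a + c + b
swap-last = solve-∀

positive-gap : ∀ {a b} → a <ᶻ b → 0ℤ <ᶻ b - a
positive-gap {a} {b} a<b = subst (_<ᶻ b - a) (ℤP.+-inverseʳ a) (ℤP.+-monoˡ-< (- a) a<b)

nonzero : ∀ {d} → 0ℤ <ᶻ d → d ≢ 0ℤ
nonzero 0<d d≡0 = ℤP.<-irrefl (sym d≡0) 0<d

multiple-nonneg : ∀ {d} → 0ℤ <ᶻ d → ∀ i → 0ℤ ≤ᶻ + i * d
multiple-nonneg 0<d i =
  ℤP.*-monoʳ-≤-nonNeg _ {{ℤ.nonNegative (ℤP.<⇒≤ 0<d)}} (ℤ.+≤+ {0} {i} z≤n)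

offset-+ : ∀ a d j t → a + + (j ℕ.+ t) * d ≡ a + + j * d + + t * d
offset-+ a d j t = trans (cong (λ n → a + n * d) (ℤP.pos-+ j t)) (distrib a d (+ j) (+ t))
  where
  distrib : ∀ a d j t → a + (j + t) * d ≡ a + j * d + t * d
  distrib = solve-∀

offset-suc : ∀ a d j → a + + suc j * d ≡ a + + j * d + d
offset-suc a d j = trans (cong (_+_ a) (ℤP.suc-* (+ j) d)) (rearrange a d (+ j))
  where
  rearrange : ∀ a d j → a + (d + j * d) ≡ a + j * d + d
  rearrange = solve-∀

OneOf : {S : Set} → S → S → S → Set
OneOf u v x = x ≡ u ⊎ x ≡ v

pigeonhole : {S : Set} {u v x y z : S} → OneOf u v x → OneOf u v y → OneOf u v z →
             x ≡ y ⊎ x ≡ z ⊎ y ≡ z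
pigeonhole (inj₁ refl) (inj₁ refl) _           = inj₁ refl
pigeonhole (inj₂ refl) (inj₂ refl) _           = inj₁ refl
pigeonhole (inj₁ refl) (inj₂ refl) (inj₁ refl) = inj₂ (inj₁ refl)
pigeonhole (inj₁ refl) (inj₂ refl) (inj₂ refl) = inj₂ (inj₂ refl)
pigeonhole (inj₂ refl) (inj₁ refl) (inj₁ refl) = inj₂ (inj₂ refl)
pigeonhole (inj₂ refl) (inj₁ refl) (inj₂ refl) = inj₂ (inj₁ refl)

∈-pair : {S : Set} {u v x : S} → x ∈ u ∷ v ∷ [] → OneOf u v x
∈-pair (here refl)         = inj₁ refl
∈-pair (there (here refl)) = inj₂ refl

two-entries : {S : Set} (X : List S) → length X ≤ 2 → ∀ {x₁ x₂ x} →
              x₁ ∈ X → x₂ ∈ X → x₁ ≢ x₂ → x ∈ X → OneOf x₁ x₂ x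
two-entries (u ∷ []) _ (here refl) (here refl) x₁≢x₂ _ = contradiction refl x₁≢x₂
two-entries (u ∷ v ∷ []) _ x₁∈ x₂∈ x₁≢x₂ x∈
  with pigeonhole (∈-pair x∈) (∈-pair x₁∈) (∈-pair x₂∈)
... | inj₁ x≡x₁        = inj₁ x≡x₁
... | inj₂ (inj₁ x≡x₂) = inj₂ x≡x₂
... | inj₂ (inj₂ x₁≡x₂) = contradiction x₁≡x₂ x₁≢x₂
two-entries (_ ∷ _ ∷ _ ∷ _) (s≤s (s≤s ()))

two-valued-length : {S : Set} {u v : S} (A : List S) → Unique A → 2 ≤ length A →
                    (∀ {x} → x ∈ A → OneOf u v x) → length A ≡ 2
two-valued-length (_ ∷ []) _ (s≤s ()) _
two-valued-length (_ ∷ _ ∷ []) _ _ _ = refl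
two-valued-length (p ∷ q ∷ s ∷ _) ((p≢q ∷ p≢s ∷ _) ∷ (q≢s ∷ _) ∷ _) _ values
  with pigeonhole (values (here refl)) (values (there (here refl)))
                  (values (there (there (here refl))))
... | inj₁ p≡q        = contradiction p≡q p≢q
... | inj₂ (inj₁ p≡s) = contradiction p≡s p≢s
... | inj₂ (inj₂ q≡s) = contradiction q≡s q≢s

record Extremes (S : ℤ → Set) (m M : ℤ) : Set where
  field
    min∈ : S m
    max∈ : S M
    min≤ : ∀ {a} → S a → m ≤ᶻ a
    ≤max : ∀ {a} → S a → a ≤ᶻ M

least : ∀ {x} (L : List ℤ) → x ∈ L → ∃[ m ] (m ∈ L × ∀ {a} → a ∈ L → m ≤ᶻ a)
least (y ∷ ys) _ = Extrema.min y ys , min∈ , bound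
  where
  min∈ : Extrema.min y ys ∈ y ∷ ys
  min∈ with Extrema.argmin-sel id y ys
  ... | inj₁ min≡y  = here min≡y
  ... | inj₂ min∈ys = there min∈ys
  bound : ∀ {a} → a ∈ y ∷ ys → Extrema.min y ys ≤ᶻ a
  bound (here refl)  = Extrema.min≤⊤ y ys
  bound (there a∈ys) = All.lookup (Extrema.min≤xs y ys) a∈ys

greatest : ∀ {x} (L : List ℤ) → x ∈ L → ∃[ M ] (M ∈ L × ∀ {a} → a ∈ L → a ≤ᶻ M)
greatest (y ∷ ys) _ = Extrema.max y ys , max∈ , bound
  where
  max∈ : Extrema.max y ys ∈ y ∷ ys
  max∈ with Extrema.argmax-sel id y ys
  ... | inj₁ max≡y  = here max≡y
  ... | inj₂ max∈ys = there max∈ys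
  bound : ∀ {a} → a ∈ y ∷ ys → a ≤ᶻ Extrema.max y ys
  bound (here refl)  = Extrema.v≤max⁺ y ys (inj₁ ℤP.≤-refl)
  bound (there a∈ys) = All.lookup (Extrema.xs≤max y ys) a∈ys

spread : (A : List ℤ) → Unique A → 2 ≤ length A →
         ∃[ m ] ∃[ M ] (m <ᶻ M × Extremes (_∈ A) m M)
spread (_ ∷ []) _ (s≤s ())
spread A@(p ∷ q ∷ _) ((p≢q ∷ _) ∷ _) _
  with least A (here refl) | greatest A (here refl)
... | m , m∈ , m≤ | M , M∈ , ≤M =
  m , M , ℤP.≤∧≢⇒< (m≤ M∈) m≢M , record { min∈ = m∈ ; max∈ = M∈ ; min≤ = m≤ ; ≤max = ≤M }
  where
  squeezed : m ≡ M → ∀ {a} → a ∈ A → a ≡ m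
  squeezed refl a∈ = ℤP.≤-antisym (≤M a∈) (m≤ a∈)
  m≢M : m ≢ M
  m≢M m≡M = p≢q (trans (squeezed m≡M (here refl)) (sym (squeezed m≡M (there (here refl)))))

next-above : ∀ {m a} (A : List ℤ) → a ∈ A → m <ᶻ a →
             ∃[ a₁ ] (a₁ ∈ A × m <ᶻ a₁ × ∀ {b} → b ∈ A → m <ᶻ b → a₁ ≤ᶻ b)
next-above {m} A a∈ m<a with least (filter (m ℤ.<?_) A) (∈-filter⁺ (m ℤ.<?_) a∈ m<a)
... | a₁ , a₁∈ , a₁≤ with ∈-filter⁻ (m ℤ.<?_) a₁∈
...   | a₁∈A , m<a₁ = a₁ , a₁∈A , m<a₁ , λ b∈ m<b → a₁≤ (∈-filter⁺ (m ℤ.<?_) b∈ m<b)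

Progression : (ℤ → Set) → ℤ → ℤ → ℕ → Set
Progression S a d k = ∀ y → S y ⇔ (∃[ i ] (i ℕ.< k × y ≡ a + + i * d))

module StepClosed {S : ℤ → Set} {m M d : ℤ} (ext : Extremes S m M) (0<d : 0ℤ <ᶻ d)
                  (step : ∀ {a} → S a → a <ᶻ M → S (a + d)) where
  open Extremes ext

  -- One step of d consumes at least one unit of fuel.
  fuel-step : ∀ a n → a + + suc n ≤ᶻ a + d + + n
  fuel-step a n = begin
    a + + suc n       ≡⟨ regroup a (+ n) ⟩
    a + + n + 1ℤ      ≤⟨ ℤP.+-monoʳ-≤ (a + + n) (ℤP.i<j⇒suc[i]≤j 0<d) ⟩
    a + + n + d       ≡⟨ swap-last a (+ n) d ⟩
    a + d + + n       ∎
    where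
    open ℤP.≤-Reasoning
    regroup : ∀ a n → a + (1ℤ + n) ≡ a + n + 1ℤ
    regroup = solve-∀

  -- Climbing from any element by steps d lands exactly on M; the fuel n
  -- bounds the number of steps.
  climb : ∀ n {a} → S a → M ≤ᶻ a + + n → ∃[ j ] M ≡ a + + j * d
  climb n {a} Sa M≤a+n with a ℤ.<? M
  ... | no a≮M = 0 , trans (ℤP.≤-antisym (ℤP.≮⇒≥ a≮M) (≤max Sa)) (sym (ℤP.+-identityʳ a))
  climb zero {a} Sa M≤a+0 | yes a<M =
    contradiction (subst (M ≤ᶻ_) (ℤP.+-identityʳ a) M≤a+0) (ℤP.<⇒≱ a<M)
  climb (suc n) {a} Sa M≤a+1+n | yes a<M =
    let j , M≡a+d+jd = climb n (step Sa a<M) (ℤP.≤-trans M≤a+1+n (fuel-step a n))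
    in suc j , trans M≡a+d+jd (trans (swap-last a d (+ j * d)) (sym (offset-suc a d j)))

  -- M - a units of fuel always suffice.
  climbs : ∀ {a} → S a → ∃[ j ] M ≡ a + + j * d
  climbs {a} Sa = climb ∣ M - a ∣ Sa (ℤP.≤-reflexive M≡a+∣M-a∣)
    where
    complement : ∀ a M → M ≡ a + (M - a)
    complement = solve-∀
    M≡a+∣M-a∣ : M ≡ a + + ∣ M - a ∣
    M≡a+∣M-a∣ = trans (complement a M)
                  (cong (_+_ a) (sym (ℤP.0≤i⇒+∣i∣≡i (ℤP.i≤j⇒0≤j-i (≤max Sa)))))

  ladder : ∀ i → m + + i * d ≤ᶻ M → S (m + + i * d)
  ladder zero _ = subst S (sym (ℤP.+-identityʳ m)) min∈
  ladder (suc i) m+[1+i]d≤M =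
    subst S (sym (offset-suc m d i)) (step (ladder i (ℤP.<⇒≤ below)) below)
    where
    below : m + + i * d <ᶻ M
    below = ℤP.<-≤-trans (subst (m + + i * d <ᶻ_) (sym (offset-suc m d i)) (<-+ _ 0<d))
                         m+[1+i]d≤M

  -- With M = m + j₀·d, an element y with M = y + j·d is m + (j₀ - j)·d, and
  -- conversely the ladder reaches every m + i·d with i ≤ j₀.
  progression : ∃[ k ] Progression S m d k
  progression with climbs min∈
  ... | j₀ , M≡m+j₀d = suc j₀ , λ y → mk⇔ (position y) (member y)
    where
    open ℤP.≤-Reasoning

    position : ∀ y → S y → ∃[ i ] (i ℕ.< suc j₀ × y ≡ m + + i * d)
    position y Sy with climbs Sy
    ... | j , M≡y+jd = t , s≤s (ℕP.m∸n≤m j₀ j) , ∙-cancelʳ (+ j * d) _ _ y+jd≡m+td+jd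
      where
      jd≤j₀d : + j * d ≤ᶻ + j₀ * d
      jd≤j₀d = cancelˡ-≤ m (begin
        m + + j * d   ≤⟨ ℤP.+-monoˡ-≤ (+ j * d) (min≤ Sy) ⟩
        y + + j * d   ≡⟨ M≡y+jd ⟨
        M             ≡⟨ M≡m+j₀d ⟩
        m + + j₀ * d  ∎)
      j≤j₀ : j ℕ.≤ j₀
      j≤j₀ = ℤP.drop‿+≤+ (ℤP.*-cancelʳ-≤-pos (+ j) (+ j₀) d {{ℤ.positive 0<d}} jd≤j₀d)
      t : ℕ
      t = j₀ ℕ.∸ j
      y+jd≡m+td+jd : y + + j * d ≡ m + + t * d + + j * d
      y+jd≡m+td+jd = ≡.begin
        y + + j * d                ≡.≡⟨ M≡y+jd ⟨
        M                          ≡.≡⟨ M≡m+j₀d ⟩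
        m + + j₀ * d               ≡.≡⟨ cong (λ n → m + + n * d) (ℕP.m+[n∸m]≡n j≤j₀) ⟨
        m + + (j ℕ.+ t) * d        ≡.≡⟨ offset-+ m d j t ⟩
        m + + j * d + + t * d      ≡.≡⟨ swap-last m (+ j * d) (+ t * d) ⟩
        m + + t * d + + j * d      ≡.∎
        where module ≡ = ≡-Reasoning

    member : ∀ y → ∃[ i ] (i ℕ.< suc j₀ × y ≡ m + + i * d) → S y
    member y (i , s≤s i≤j₀ , refl) = ladder i (begin
      m + + i * d                ≤⟨ ≤-+ _ (multiple-nonneg 0<d (j₀ ℕ.∸ i)) ⟩
      m + + i * d + + (j₀ ℕ.∸ i) * d ≡⟨ offset-+ m d i (j₀ ℕ.∸ i) ⟨
      m + + (i ℕ.+ (j₀ ℕ.∸ i)) * d ≡⟨ cong (λ n → m + + n * d) (ℕP.m+[n∸m]≡n i≤j₀) ⟩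
      m + + j₀ * d               ≡⟨ M≡m+j₀d ⟨
      M                          ∎)

-- Reflection y ↦ - y, used to reduce a descending step to an ascending one.

Neg : (ℤ → Set) → ℤ → Set
Neg S y = S (- y)

into-neg : ∀ (S : ℤ → Set) {y} → S y → Neg S (- y)
into-neg S {y} = subst S (sym (ℤP.neg-involutive y))

out-of-neg : ∀ (S : ℤ → Set) {y} → Neg S (- y) → S y
out-of-neg S {y} = subst S (ℤP.neg-involutive y)

extremes-neg : ∀ {S m M} → Extremes S m M → Extremes (Neg S) (- M) (- m)
extremes-neg {S} {m} {M} ext = record
  { min∈ = into-neg S max∈
  ; max∈ = into-neg S min∈
  ; min≤ = λ {a} Sa → subst (- M ≤ᶻ_) (ℤP.neg-involutive a) (ℤP.neg-mono-≤ (≤max Sa))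
  ; ≤max = λ {a} Sa → subst (_≤ᶻ - m) (ℤP.neg-involutive a) (ℤP.neg-mono-≤ (min≤ Sa))
  }
  where open Extremes ext

progression-neg : ∀ {S a d k} → Progression (Neg S) a d k → Progression S (- a) (- d) k
progression-neg {S} {a} {d} prog y = mk⇔
  (λ Sy → reflect (Equivalence.to (prog (- y)) (into-neg S Sy)))
  (λ (i , i<k , y≡) → out-of-neg S (Equivalence.from (prog (- y))
                                      (i , i<k , trans (cong -_ y≡) (neg-term′ a d (+ i)))))
  where
  neg-term : ∀ a d i → - (a + i * d) ≡ - a + i * - d
  neg-term = solve-∀
  neg-term′ : ∀ a d i → - (- a + i * - d) ≡ a + i * d
  neg-term′ = solve-∀
  reflect : ∃[ i ] (i ℕ.< _ × - y ≡ a + + i * d) → ∃[ i ] (i ℕ.< _ × y ≡ - a + + i * - d)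
  reflect (i , i<k , -y≡) =
    i , i<k , trans (sym (ℤP.neg-involutive y)) (trans (cong -_ -y≡) (neg-term a d (+ i)))

sumset-zero : ∀ {A} → InSumset 0 A 0ℤ
sumset-zero = (λ ()) , (λ ()) , refl

sumset-cons : ∀ {h A x y} → x ∈ A → InSumset h A y → InSumset (suc h) A (x + y)
sumset-cons x∈ (f , f∈ , refl) = (_ Vector.∷ f) , (λ { fzero → x∈ ; (fsuc i) → f∈ i }) , refl

sumFin-const : ∀ h c → sumFin {h} (λ _ → c) ≡ + h * c
sumFin-const zero    c = refl
sumFin-const (suc h) c = trans (cong (_+_ c) (sumFin-const h c)) (sym (ℤP.suc-* (+ h) c))

sumset-const : ∀ h {A c} → c ∈ A → InSumset h A (+ h * c)
sumset-const h c∈ = (λ _ → _) , (λ _ → c∈) , sumFin-const h _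

sumset-pair : ∀ {A u v} → u ∈ A → v ∈ A → InSumset 2 A (u + v)
sumset-pair {u = u} u∈ v∈ =
  subst (InSumset 2 _) (cong (_+_ u) (ℤP.+-identityʳ _)) (sumset-cons u∈ (sumset-cons v∈ sumset-zero))

sumset-pair⁻ : ∀ {A y} → InSumset 2 A y → ∃[ u ] ∃[ v ] (u ∈ A × v ∈ A × y ≡ u + v)
sumset-pair⁻ (f , f∈ , refl) =
  f fzero , f (fsuc fzero) , f∈ _ , f∈ _ , cong (_+_ (f fzero)) (ℤP.+-identityʳ _)

sumset-triple⁻ : ∀ {A y} → InSumset 3 A y →
                 ∃[ u ] ∃[ v ] ∃[ w ] (u ∈ A × v ∈ A × w ∈ A × y ≡ u + (v + w))
sumset-triple⁻ (f , f∈ , refl) =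
  f fzero , f (fsuc fzero) , f (fsuc (fsuc fzero)) , f∈ _ , f∈ _ , f∈ _ ,
  cong (λ z → f fzero + (f (fsuc fzero) + z)) (ℤP.+-identityʳ _)

Translate : ℤ → (ℤ → Set) → ℤ → Set
Translate x S y = ∃[ b ] (S b × y ≡ x + b)

PairCover : (ℤ → Set) → ℤ → ℤ → Set
PairCover S x₁ x₂ = ∀ {a c} → S a → S c → Translate x₁ S (a + c) ⊎ Translate x₂ S (a + c)

-- Structure of a cover rA ⊆ X + A with |X| ≤ 2 and r ≥ 2.

-- rA ⊆ (x₁ + A) ∪ (x₂ + A), where x₁ + A is the translate covering r·m and
-- x₂ + A the one covering r·M; the bounds record that b ≥ m, resp. b ≤ M,
-- for the elements b of A involved.
record TwoTranslates (r : ℕ) (A : List ℤ) (m M : ℤ) : Set where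
  field
    x₁ x₂   : ℤ
    x₁-low  : x₁ + m ≤ᶻ + r * m
    x₂-high : + r * M ≤ᶻ x₂ + M
    covers  : ∀ {y} → InSumset r A y → Translate x₁ (_∈ A) y ⊎ Translate x₂ (_∈ A) y

multiple-spread : ∀ k {m M} → m <ᶻ M → + (2 ℕ.+ k) * m + M <ᶻ + (2 ℕ.+ k) * M + m
multiple-spread k {m} {M} m<M = begin-strict
  + (2 ℕ.+ k) * m + M    ≡⟨ split-off (+ suc k) m M ⟩
  + suc k * m + (m + M)  <⟨ ℤP.+-monoˡ-< (m + M) (ℤP.*-monoˡ-<-pos (+ suc k) m<M) ⟩
  + suc k * M + (m + M)  ≡⟨ split-off′ (+ suc k) m M ⟩
  + (2 ℕ.+ k) * M + m    ∎
  where
  open ℤP.≤-Reasoning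
  split-off : ∀ K m M → (1ℤ + K) * m + M ≡ K * m + (m + M)
  split-off = solve-∀
  split-off′ : ∀ K m M → K * M + (m + M) ≡ (1ℤ + K) * M + m
  split-off′ = solve-∀

-- If rA ⊆ X + A with |X| ≤ 2 and r ≥ 2, the translates covering r·m and r·M
-- are distinct, so they are all of X.
two-translates : ∀ k {A m M} → Extremes (_∈ A) m M → m <ᶻ M →
                 (X : List ℤ) → length X ≤ 2 → (∀ y → InSumset (2 ℕ.+ k) A y → InPlus X A y) →
                 TwoTranslates (2 ℕ.+ k) A m M
two-translates k {A} {m} {M} ext m<M X |X|≤2 cover
  with cover _ (sumset-const (2 ℕ.+ k) (Extremes.min∈ ext))
     | cover _ (sumset-const (2 ℕ.+ k) (Extremes.max∈ ext))
... | x₁ , b₁ , x₁∈ , b₁∈ , rm≡x₁+b₁ | x₂ , b₂ , x₂∈ , b₂∈ , rM≡x₂+b₂ = record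
  { x₁ = x₁ ; x₂ = x₂ ; x₁-low = x₁-low ; x₂-high = x₂-high ; covers = covers }
  where
  open Extremes ext
  open ℤP.≤-Reasoning
  r = 2 ℕ.+ k

  x₁-low : x₁ + m ≤ᶻ + r * m
  x₁-low = subst (x₁ + m ≤ᶻ_) (sym rm≡x₁+b₁) (ℤP.+-monoʳ-≤ x₁ (min≤ b₁∈))

  x₂-high : + r * M ≤ᶻ x₂ + M
  x₂-high = subst (_≤ᶻ x₂ + M) (sym rM≡x₂+b₂) (ℤP.+-monoʳ-≤ x₂ (≤max b₂∈))

  x₁≢x₂ : x₁ ≢ x₂
  x₁≢x₂ x₁≡x₂ = ℤP.<⇒≱ (multiple-spread k m<M) (begin
    + r * M + m    ≤⟨ ℤP.+-monoˡ-≤ m x₂-high ⟩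
    x₂ + M + m     ≡⟨ cong (λ x → x + M + m) x₁≡x₂ ⟨
    x₁ + M + m     ≡⟨ swap-last x₁ M m ⟩
    x₁ + m + M     ≤⟨ ℤP.+-monoˡ-≤ M x₁-low ⟩
    + r * m + M    ∎)

  covers : ∀ {y} → InSumset r A y → Translate x₁ (_∈ A) y ⊎ Translate x₂ (_∈ A) y
  covers s with cover _ s
  ... | x , b , x∈ , b∈ , y≡x+b with two-entries X |X|≤2 x₁∈ x₂∈ x₁≢x₂ x∈
  ...   | inj₁ refl = inj₁ (b , b∈ , y≡x+b)
  ...   | inj₂ refl = inj₂ (b , b∈ , y≡x+b)

gap : ∀ {r A m M y} → Extremes (_∈ A) m M → TwoTranslates r A m M → InSumset r A y →
      y + m ≤ᶻ + r * m + M ⊎ + r * M + m ≤ᶻ y + M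
gap {r} {m = m} {M} ext T s with TwoTranslates.covers T s
... | inj₁ (b , b∈ , refl) = inj₁ (begin
  x₁ + b + m     ≡⟨ swap-last x₁ b m ⟩
  x₁ + m + b     ≤⟨ ℤP.+-mono-≤ x₁-low (≤max b∈) ⟩
  + r * m + M    ∎)
  where open TwoTranslates T; open Extremes ext; open ℤP.≤-Reasoning
... | inj₂ (b , b∈ , refl) = inj₂ (begin
  + r * M + m    ≤⟨ ℤP.+-mono-≤ x₂-high (min≤ b∈) ⟩
  x₂ + M + b     ≡⟨ swap-last x₂ M b ⟩
  x₂ + b + M     ∎)
  where open TwoTranslates T; open Extremes ext; open ℤP.≤-Reasoning

-- The case r ≥ 3: only r = 3 and A = {m, M} survive.

-- For r = 3 + j every element c > m of A satisfies c ≥ M + j·(M - m), because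
-- the element M + c + (1 + j)·m of rA cannot lie below the gap.
far-from-min : ∀ j {A m M c} → Extremes (_∈ A) m M → TwoTranslates (3 ℕ.+ j) A m M →
               c ∈ A → m <ᶻ c → M + + j * (M - m) ≤ᶻ c
far-from-min j {A} {m} {M} {c} ext T c∈ m<c
  with gap ext T (sumset-cons (Extremes.max∈ ext)
                   (sumset-cons c∈ (sumset-const (suc j) (Extremes.min∈ ext))))
... | inj₁ below = contradiction (cancelʳ-≤ _ (begin
  c + (M + (1ℤ + (1ℤ + J)) * m)              ≡⟨ low-left c m M J ⟩
  M + (c + (1ℤ + J) * m) + m                 ≤⟨ below ⟩
  (1ℤ + (1ℤ + (1ℤ + J))) * m + M             ≡⟨ low-right m M J ⟩
  m + (M + (1ℤ + (1ℤ + J)) * m)              ∎)) (ℤP.<⇒≱ m<c)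
  where
  open ℤP.≤-Reasoning
  J = + j
  low-left : ∀ c m M J → c + (M + (1ℤ + (1ℤ + J)) * m) ≡ M + (c + (1ℤ + J) * m) + m
  low-left = solve-∀
  low-right : ∀ m M J → (1ℤ + (1ℤ + (1ℤ + J))) * m + M ≡ m + (M + (1ℤ + (1ℤ + J)) * m)
  low-right = solve-∀
... | inj₂ above = cancelʳ-≤ _ (begin
  M + J * (M - m) + (M + M + (1ℤ + J) * m)   ≡⟨ high-left m M J ⟩
  (1ℤ + (1ℤ + (1ℤ + J))) * M + m             ≤⟨ above ⟩
  M + (c + (1ℤ + J) * m) + M                 ≡⟨ high-right c m M J ⟩
  c + (M + M + (1ℤ + J) * m)                 ∎)
  where
  open ℤP.≤-Reasoning
  J = + j
  high-left : ∀ m M J → M + J * (M - m) + (M + M + (1ℤ + J) * m) ≡ (1ℤ + (1ℤ + (1ℤ + J))) * M + m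
  high-left = solve-∀
  high-right : ∀ c m M J → M + (c + (1ℤ + J) * m) + M ≡ c + (M + M + (1ℤ + J) * m)
  high-right = solve-∀

-- For r ≥ 4 this is absurd for c = M.
no-fourfold : ∀ j {A m M} → Extremes (_∈ A) m M → m <ᶻ M → TwoTranslates (4 ℕ.+ j) A m M → ⊥
no-fourfold j {m = m} {M} ext m<M T =
  ℤP.<⇒≱ (<-+ M 0<[1+j][M-m]) (far-from-min (suc j) ext T (Extremes.max∈ ext) m<M)
  where
  0<[1+j][M-m] : 0ℤ <ᶻ + suc j * (M - m)
  0<[1+j][M-m] = subst (_<ᶻ + suc j * (M - m)) (ℤP.*-zeroʳ (+ suc j))
                   (ℤP.*-monoˡ-<-pos (+ suc j) (positive-gap m<M))

threefold-extremes : ∀ {A m M} → Extremes (_∈ A) m M → TwoTranslates 3 A m M →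
                     ∀ {c} → c ∈ A → OneOf m M c
threefold-extremes {m = m} {M} ext T {c} c∈ with c ℤ.≟ m
... | yes c≡m = inj₁ c≡m
... | no c≢m  = inj₂ (ℤP.≤-antisym (≤max c∈) M≤c)
  where
  open Extremes ext
  M≤c : M ≤ᶻ c
  M≤c = subst (_≤ᶻ c) (ℤP.+-identityʳ M)
          (far-from-min 0 ext T c∈ (ℤP.≤∧≢⇒< (min≤ c∈) (λ m≡c → c≢m (sym m≡c))))

-- The case r = 2: A is an arithmetic progression.

translate-neg : ∀ {S x y} → Translate x S (- y) → Translate (- x) (Neg S) y
translate-neg {S} {x} {y} (b , Sb , -y≡x+b) =
  - b , into-neg S Sb ,
  trans (sym (ℤP.neg-involutive y)) (trans (cong -_ -y≡x+b) (ℤP.neg-distrib-+ x b))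

pair-cover-neg : ∀ {S x₁ x₂} → PairCover S x₁ x₂ → PairCover (Neg S) (- x₂) (- x₁)
pair-cover-neg {S} {x₁} {x₂} cover {a} {c} Sa Sc =
  swap (map (reflect {x₁}) (reflect {x₂}) (cover Sa Sc))
  where
  reflect : ∀ {x} → Translate x S (- a + - c) → Translate (- x) (Neg S) (a + c)
  reflect {x} t = translate-neg {x = x} (subst (Translate x S) (sym (ℤP.neg-distrib-+ a c)) t)

-- If M ≤ x₂ then m + a lies in x₁ + S for every a < M in S, so S is closed
-- under the step a ↦ a + (m - x₁) below M.
shift-closed : ∀ {S m M x₁ x₂} → Extremes S m M → PairCover S x₁ x₂ → M ≤ᶻ x₂ →
               ∀ {a} → S a → a <ᶻ M → S (a + (m - x₁))
shift-closed {S} {m} {M} {x₁} {x₂} ext cover M≤x₂ {a} Sa a<M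
  with cover (Extremes.min∈ ext) Sa
... | inj₁ (b , Sb , m+a≡x₁+b) = subst S (trans (summand m+a≡x₁+b) (regroup m a x₁)) Sb
  where
  regroup : ∀ m a x → m + a - x ≡ a + (m - x)
  regroup = solve-∀
... | inj₂ (b , Sb , m+a≡x₂+b) = contradiction m+a≡x₂+b (ℤP.<⇒≢ (begin-strict
  m + a    <⟨ ℤP.+-monoʳ-< m a<M ⟩
  m + M    ≡⟨ ℤP.+-comm m M ⟩
  M + m    ≤⟨ ℤP.+-mono-≤ M≤x₂ (Extremes.min≤ ext Sb) ⟩
  x₂ + b   ∎))
  where open ℤP.≤-Reasoning

successor-closed : ∀ {S m M a₁} → Extremes S m M → PairCover S m M →
                   S a₁ → (∀ {b} → S b → m <ᶻ b → a₁ ≤ᶻ b) →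
                   ∀ {a} → S a → a <ᶻ M → S (a + (a₁ - m))
successor-closed {S} {m} {M} {a₁} ext cover Sa₁ a₁-least {a} Sa a<M with cover Sa Sa₁
... | inj₁ (b , Sb , a+a₁≡m+b) = subst S (trans (summand a+a₁≡m+b) (regroup a a₁ m)) Sb
  where
  regroup : ∀ a a₁ m → a + a₁ - m ≡ a + (a₁ - m)
  regroup = solve-∀
... | inj₂ (b , Sb , a+a₁≡M+b) = subst S M≡a+[a₁-m] (Extremes.max∈ ext)
  where
  open ℤP.≤-Reasoning
  -- b < a₁ since a < M, hence b = m by the minimality of a₁.
  b≡m : b ≡ m
  b≡m with m ℤ.<? b
  ... | yes m<b = contradiction a+a₁≡M+b (ℤP.<⇒≢ (begin-strict
    a + a₁   <⟨ ℤP.+-monoˡ-< a₁ a<M ⟩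
    M + a₁   ≤⟨ ℤP.+-monoʳ-≤ M (a₁-least Sb m<b) ⟩
    M + b    ∎))
  ... | no m≮b  = ℤP.≤-antisym (ℤP.≮⇒≥ m≮b) (Extremes.min≤ ext Sb)
  M≡a+[a₁-m] : M ≡ a + (a₁ - m)
  M≡a+[a₁-m] = ≡.begin
    M                 ≡.≡⟨ cancel M m ⟨
    M + m - m         ≡.≡⟨ cong (λ x → M + x - m) b≡m ⟨
    M + b - m         ≡.≡⟨ cong (_- m) a+a₁≡M+b ⟨
    a + a₁ - m        ≡.≡⟨ regroup a a₁ m ⟩
    a + (a₁ - m)      ≡.∎
    where
    module ≡ = ≡-Reasoning
    cancel : ∀ x y → x + y - y ≡ x
    cancel = solve-∀
    regroup : ∀ a a₁ m → a + a₁ - m ≡ a + (a₁ - m)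
    regroup = solve-∀

closed⇒progression : ∀ {A m M d} → Extremes (_∈ A) m M → 0ℤ <ᶻ d →
                     (∀ {a} → a ∈ A → a <ᶻ M → (a + d) ∈ A) → IsAP A
closed⇒progression {m = m} {d = d} ext 0<d step =
  let k , prog = StepClosed.progression ext 0<d step in m , d , k , nonzero 0<d , prog

reflected-closed⇒progression : ∀ {A m M d} → Extremes (_∈ A) m M → 0ℤ <ᶻ d →
                               (∀ {a} → Neg (_∈ A) a → a <ᶻ - m → Neg (_∈ A) (a + d)) → IsAP A
reflected-closed⇒progression {A} {M = M} {d = d} ext 0<d step =
  let k , prog = StepClosed.progression (extremes-neg ext) 0<d step
  in - - M , - d , k , (λ -d≡0 → nonzero 0<d (ℤP.neg-injective -d≡0)) ,
     progression-neg {S = _∈ A} { - M} {d} prog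

pair-cover⇒progression : ∀ {A m M x₁ x₂} → Extremes (_∈ A) m M → m <ᶻ M →
                         PairCover (_∈ A) x₁ x₂ → x₁ ≤ᶻ m → M ≤ᶻ x₂ → IsAP A
pair-cover⇒progression {A} {m} {M} {x₁} {x₂} ext m<M cover x₁≤m M≤x₂
  with x₁ ℤ.<? m | M ℤ.<? x₂
... | yes x₁<m | _ =
  closed⇒progression ext (positive-gap x₁<m) (shift-closed ext cover M≤x₂)
... | no _ | yes M<x₂ =
  reflected-closed⇒progression ext (positive-gap (ℤP.neg-mono-< M<x₂))
    (shift-closed (extremes-neg ext) (pair-cover-neg {x₁ = x₁} {x₂} cover) (ℤP.neg-mono-≤ x₁≤m))
... | no x₁≮m | no M≮x₂ with next-above A (Extremes.max∈ ext) m<M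
...   | a₁ , a₁∈ , m<a₁ , a₁-least =
  closed⇒progression ext (positive-gap m<a₁) (successor-closed ext cover′ a₁∈ a₁-least)
  where
  cover′ : PairCover (_∈ A) m M
  cover′ = subst₂ (PairCover (_∈ A)) (ℤP.≤-antisym x₁≤m (ℤP.≮⇒≥ x₁≮m))
                                     (ℤP.≤-antisym (ℤP.≮⇒≥ M≮x₂) M≤x₂) cover

twofold-progression : ∀ {A m M} → Extremes (_∈ A) m M → m <ᶻ M → TwoTranslates 2 A m M → IsAP A
twofold-progression {m = m} {M} ext m<M T =
  pair-cover⇒progression {x₁ = x₁} {x₂} ext m<M (λ a∈ c∈ → covers (sumset-pair a∈ c∈))
    (cancelʳ-≤ m (subst (x₁ + m ≤ᶻ_) (double m) x₁-low))
    (cancelʳ-≤ M (subst (_≤ᶻ x₂ + M) (double M) x₂-high))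
  where
  open TwoTranslates T
  double : ∀ a → + 2 * a ≡ a + a
  double = solve-∀

-- The converse: progressions for r = 2 and two-element sets for r = 3.

progression-sum : ∀ a d i j → a + + i * d + (a + + j * d) ≡ a + (a + + (i ℕ.+ j) * d)
progression-sum a d i j = trans (regroup a d (+ i) (+ j)) (cong (_+_ a) (sym (offset-+ a d i j)))
  where
  regroup : ∀ a d i j → a + i * d + (a + j * d) ≡ a + (a + i * d + j * d)
  regroup = solve-∀

progression-point : ∀ {S a d K n} → Progression S a d (suc K) → n ≤ K → S (a + + n * d)
progression-point prog n≤K = Equivalence.from (prog _) (_ , s≤s n≤K , refl)

-- The progression a, …, a + K·d is pair-covered by a and a + K·d: the sum
-- (a + i·d) + (a + j·d) equals a + (a + (i + j)·d) if i + j ≤ K and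
-- (a + K·d) + (a + (i + j - K)·d) otherwise.
progression-pair-cover : ∀ {S a d K} → Progression S a d (suc K) → PairCover S a (a + + K * d)
progression-pair-cover {S} {a} {d} {K} prog Su Sv
  with Equivalence.to (prog _) Su | Equivalence.to (prog _) Sv
... | i , s≤s i≤K , refl | j , s≤s j≤K , refl with i ℕ.+ j ℕ.≤? K
...   | yes i+j≤K = inj₁ (_ , progression-point {S} {a} {d} prog i+j≤K , progression-sum a d i j)
...   | no i+j≰K = inj₂ (_ , progression-point {S} {a} {d} prog t≤K , wrapped)
  where
  open ≡-Reasoning
  t = i ℕ.+ j ℕ.∸ K
  K+t≡i+j : K ℕ.+ t ≡ i ℕ.+ j
  K+t≡i+j = ℕP.m+[n∸m]≡n (ℕP.<⇒≤ (ℕP.≰⇒> i+j≰K))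
  t≤K : t ≤ K
  t≤K = ℕP.+-cancelˡ-≤ K t K (subst (_≤ K ℕ.+ K) (sym K+t≡i+j) (ℕP.+-mono-≤ i≤K j≤K))
  wrapped : a + + i * d + (a + + j * d) ≡ a + + K * d + (a + + t * d)
  wrapped = begin
    a + + i * d + (a + + j * d)   ≡⟨ progression-sum a d i j ⟩
    a + (a + + (i ℕ.+ j) * d)     ≡⟨ cong (λ n → a + (a + + n * d)) K+t≡i+j ⟨
    a + (a + + (K ℕ.+ t) * d)     ≡⟨ progression-sum a d K t ⟨
    a + + K * d + (a + + t * d)   ∎

pair-cover⇒approx : ∀ {A x₁ x₂ a} → a ∈ A → PairCover (_∈ A) x₁ x₂ → ApproxGroup 2 2 A
pair-cover⇒approx {A} {x₁} {x₂} a∈ cover = (_ , a∈) , x₁ ∷ x₂ ∷ [] , ℕP.≤-refl , covered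
  where
  covered : ∀ y → InSumset 2 A y → InPlus (x₁ ∷ x₂ ∷ []) A y
  covered y s with sumset-pair⁻ s
  ... | u , v , u∈ , v∈ , refl with cover u∈ v∈
  ...   | inj₁ (b , b∈ , u+v≡x₁+b) = x₁ , b , here refl , b∈ , u+v≡x₁+b
  ...   | inj₂ (b , b∈ , u+v≡x₂+b) = x₂ , b , there (here refl) , b∈ , u+v≡x₂+b

progression⇒approx : ∀ {A a} → a ∈ A → IsAP A → ApproxGroup 2 2 A
progression⇒approx a∈ (a₀ , d , k , _ , prog) with Equivalence.to (prog _) a∈
... | _ , s≤s {n = K} _ , _ =
  pair-cover⇒approx {x₁ = a₀} {a₀ + + K * d} a∈ (progression-pair-cover {a = a₀} {d} prog)

-- A set {p, q} satisfies 3A ⊆ {2p, 2q} + A, since two of any three summands agree.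
length-two⇒approx : (A : List ℤ) → length A ≡ 2 → ApproxGroup 3 2 A
length-two⇒approx A@(p ∷ q ∷ []) refl = (p , here refl) , X , ℕP.≤-refl , covered
  where
  X = p + p ∷ q + q ∷ []
  doubled : ∀ {u b y} → u ∈ A → b ∈ A → y ≡ u + u + b → InPlus X A y
  doubled u∈ b∈ y≡ = _ , _ , double∈ (∈-pair u∈) , b∈ , y≡
    where
    double∈ : ∀ {u} → OneOf p q u → u + u ∈ X
    double∈ (inj₁ refl) = here refl
    double∈ (inj₂ refl) = there (here refl)
  covered : ∀ y → InSumset 3 A y → InPlus X A y
  covered y s with sumset-triple⁻ s
  ... | u , v , w , u∈ , v∈ , w∈ , refl with pigeonhole (∈-pair u∈) (∈-pair v∈) (∈-pair w∈)
  ...   | inj₁ refl        = doubled u∈ w∈ (first-second u w)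
    where
    first-second : ∀ u w → u + (u + w) ≡ u + u + w
    first-second = solve-∀
  ...   | inj₂ (inj₁ refl) = doubled u∈ v∈ (first-third u v)
    where
    first-third : ∀ u v → u + (v + u) ≡ u + u + v
    first-third = solve-∀
  ...   | inj₂ (inj₂ refl) = doubled v∈ u∈ (second-third u v)
    where
    second-third : ∀ u v → u + (v + v) ≡ v + v + u
    second-third = solve-∀

mainTheorem2 : (A : List ℤ) → Unique A → 2 ≤ length A → (r : ℕ) → 2 ≤ r →
    ApproxGroup r 2 A ⇔ ((r ≡ 2 × IsAP A) ⊎ (r ≡ 3 × length A ≡ 2))
mainTheorem2 A unique 2≤|A| r 2≤r with spread A unique 2≤|A|
... | m , M , m<M , ext = mk⇔ (forward r 2≤r) backward
  where
  classify : ∀ k → TwoTranslates (2 ℕ.+ k) A m M →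
             (2 ℕ.+ k ≡ 2 × IsAP A) ⊎ (2 ℕ.+ k ≡ 3 × length A ≡ 2)
  classify zero T          = inj₁ (refl , twofold-progression ext m<M T)
  classify (suc zero) T    =
    inj₂ (refl , two-valued-length A unique 2≤|A| (threefold-extremes ext T))
  classify (suc (suc j)) T = ⊥-elim (no-fourfold j ext m<M T)

  forward : ∀ r → 2 ≤ r → ApproxGroup r 2 A → (r ≡ 2 × IsAP A) ⊎ (r ≡ 3 × length A ≡ 2)
  forward (suc zero) (s≤s ())
  forward (suc (suc k)) _ (_ , X , |X|≤2 , cover) =
    classify k (two-translates k ext m<M X |X|≤2 cover)

  backward : (r ≡ 2 × IsAP A) ⊎ (r ≡ 3 × length A ≡ 2) → ApproxGroup r 2 A
  backward (inj₁ (refl , ap))    = progression⇒approx (Extremes.min∈ ext) ap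
  backward (inj₂ (refl , |A|≡2)) = length-two⇒approx A |A|≡2
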